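{- For a positive integer $d$ define the formal power series in $x_1,\dots,x_d$ \[ A_d(x_1,\dots,x_d)=\sum_{k_1=0}^{\infty}\sum_{k_2=0}^{k_1+1}\cdots\sum_{k_d=0}^{k_{d-1}+1}x_1^{k_1}x_2^{k_2}\cdots x_d^{k_d}. \] Then for all integers $d>1$, \[ A_d(x_1,\dots,x_d)=\frac{A_{d-1}(x_1,\dots,x_{d-1})-x_d^2\,A_{d-1}(x_1,\dots,x_{d-2},x_{d-1}x_d)}{1-x_d}. \] -}

module Defs where

open import Data.Nat using (ℕ; zero; suc; _≤ᵇ_; _≡ᵇ_)
open import Data.Bool using (Bool; true; false; _∧_; if_then_else_)
open import Data.Integer using (ℤ; 0ℤ; 1ℤ; _+_; _-_)
open import Data.Vec using (Vec; []; _∷_; _∷ʳ_; init; last)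
open import Relation.Binary.PropositionalEquality using (_≡_)

-- Formal power series in d variables x₁,…,x_d with integer coefficients,
-- given by their coefficient function: a monomial x₁^k₁⋯x_d^k_d is
-- identified with its exponent vector (k₁ , … , k_d).
FPS : ℕ → Set
FPS d = Vec ℕ d → ℤ

_≋_ : ∀ {d} → FPS d → FPS d → Set
f ≋ g = ∀ k → f k ≡ g k

_⊖_ : ∀ {d} → FPS d → FPS d → FPS d
(f ⊖ g) k = f k - g k

admissible : ∀ {d} → Vec ℕ d → Bool
admissible [] = true
admissible (k ∷ []) = true
admissible (k ∷ k' ∷ ks) = (k' ≤ᵇ suc k) ∧ admissible (k' ∷ ks)

A : (d : ℕ) → FPS d
A d k = if admissible k then 1ℤ else 0ℤ

-- A series in x₁,…,x_d viewed as a series in x₁,…,x_d,x_{d+1}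
-- (not involving the new last variable).
embed : ∀ {d} → FPS d → FPS (suc d)
embed f k = if last k ≡ᵇ 0 then f (init k) else 0ℤ

-- Multiplication by x_last ^ m.
mulLastPow : ∀ {d} → ℕ → FPS (suc d) → FPS (suc d)
mulLastPow {d} m f k = go m (last k)
  where
  go : ℕ → ℕ → ℤ
  go zero    b       = f (init k ∷ʳ b)
  go (suc m) zero    = 0ℤ
  go (suc m) (suc b) = go m b

-- Substitution: for C(y₁,…,y_{e+1}), the series
-- C(x₁,…,x_e, x_{e+1} x_{e+2}) in e+2 variables.
-- (x_{e+1} x_{e+2})^a = x_{e+1}^a x_{e+2}^a, so the coefficient of
-- x^k (with k = (k', a, b)) is C_(k',a) if a = b and 0 otherwise.
substProdLast : ∀ {e} → FPS (suc e) → FPS (suc (suc e))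
substProdLast C k = if last (init k) ≡ᵇ last k then C (init k) else 0ℤ

sumTo : (ℕ → ℤ) → ℕ → ℤ
sumTo g zero    = g 0
sumTo g (suc b) = sumTo g b + g (suc b)

-- Division by (1 - x_last) in the power series ring, i.e. multiplication
-- by its inverse Σ_{j≥0} x_last^j: coefficient of x^(k', b) is
-- Σ_{j=0}^{b} g_(k', j).
divOneMinusLast : ∀ {d} → FPS (suc d) → FPS (suc d)
divOneMinusLast g k = sumTo (λ j → g (init k ∷ʳ j)) (last k)

-- Write x for the last variable and fix the other exponents (v, a). Admissibility of (v, a, b) is
-- admissibility of (v, a) together with b ≤ a + 1, so the x-slice of A_d is
-- A_{d-1}(v, a) (1 + x + ⋯ + x^{a+1}). The x-slice of the numerator is A_{d-1}(v, a) (1 − x^{a+2}):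
-- x² is the factor x_d², and x^a comes from the substitution x_{d-1} ↦ x_{d-1} x_d. Dividing by
-- 1 − x takes partial sums, and those of 1 − x^{a+2} are the same geometric polynomial.
module Submission where

open import Defs
open import Data.Nat using (ℕ; zero; suc; _≤ᵇ_; _<ᵇ_; _≡ᵇ_)
open import Data.Bool using (true; false; not; _∧_; if_then_else_)
open import Data.Bool.Properties using (∧-identityʳ; ∧-assoc; ∧-comm; if-∧)
open import Data.Integer using (ℤ; 0ℤ; 1ℤ; _+_; _-_)
open import Data.Integer.Properties using (+-identityˡ; +-identityʳ; +-inverseʳ; +-assoc)
open import Data.Integer.Tactic.RingSolver using (solve-∀)
open import Data.Vec using (Vec; []; _∷_; _∷ʳ_; init; last; initLast)
open import Data.Vec.Properties using (init-∷ʳ; last-∷ʳ)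
open import Data.Product using (proj₂)
open import Relation.Binary.PropositionalEquality using (_≡_; refl; sym; trans; cong; cong₂; module ≡-Reasoning)

open ≡-Reasoning

≤ᵇ≡<ᵇ-suc : ∀ m n → (m ≤ᵇ n) ≡ (m <ᵇ suc n)
≤ᵇ≡<ᵇ-suc zero    n = refl
≤ᵇ≡<ᵇ-suc (suc m) n = refl

not-<ᵇ : ∀ m n → not (m <ᵇ n) ≡ (n ≤ᵇ m)
not-<ᵇ m       zero    = refl
not-<ᵇ zero    (suc n) = refl
not-<ᵇ (suc m) (suc n) = trans (not-<ᵇ m n) (≤ᵇ≡<ᵇ-suc n m)

monomial : ℕ → ℤ → ℕ → ℤ
monomial n c j = if n ≡ᵇ j then c else 0ℤ

+-minus-interchange : ∀ a b c d → (a - b) + (c - d) ≡ (a + c) - (b + d)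
+-minus-interchange = solve-∀

sumTo-cong : ∀ {f g : ℕ → ℤ} → (∀ j → f j ≡ g j) → ∀ b → sumTo f b ≡ sumTo g b
sumTo-cong f≡g zero    = f≡g 0
sumTo-cong f≡g (suc b) = cong₂ _+_ (sumTo-cong f≡g b) (f≡g (suc b))

sumTo-suc : ∀ (f : ℕ → ℤ) b → sumTo f (suc b) ≡ f 0 + sumTo (λ j → f (suc j)) b
sumTo-suc f zero    = refl
sumTo-suc f (suc b) = trans (cong (_+ f (suc (suc b))) (sumTo-suc f b)) (+-assoc (f 0) _ _)

sumTo-minus : ∀ (f g : ℕ → ℤ) b → sumTo (λ j → f j - g j) b ≡ sumTo f b - sumTo g b
sumTo-minus f g zero    = refl
sumTo-minus f g (suc b) = begin
  sumTo (λ j → f j - g j) b + (f (suc b) - g (suc b))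
    ≡⟨ cong (_+ (f (suc b) - g (suc b))) (sumTo-minus f g b) ⟩
  (sumTo f b - sumTo g b) + (f (suc b) - g (suc b))
    ≡⟨ +-minus-interchange (sumTo f b) (sumTo g b) (f (suc b)) (g (suc b)) ⟩
  (sumTo f b + f (suc b)) - (sumTo g b + g (suc b)) ∎

sumTo-monomial : ∀ n c b → sumTo (monomial n c) b ≡ (if n ≤ᵇ b then c else 0ℤ)
sumTo-monomial zero    c zero    = refl
sumTo-monomial zero    c (suc b) = trans (+-identityʳ _) (sumTo-monomial zero c b)
sumTo-monomial (suc n) c zero    = refl
sumTo-monomial (suc n) c (suc b) = begin
  sumTo (monomial (suc n) c) (suc b)  ≡⟨ sumTo-suc (monomial (suc n) c) b ⟩
  0ℤ + sumTo (monomial n c) b         ≡⟨ +-identityˡ _ ⟩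
  sumTo (monomial n c) b              ≡⟨ sumTo-monomial n c b ⟩
  (if n ≤ᵇ b then c else 0ℤ)          ≡⟨ cong (if_then c else 0ℤ) (≤ᵇ≡<ᵇ-suc n b) ⟩
  (if suc n ≤ᵇ suc b then c else 0ℤ)  ∎

minus-if : ∀ c p → c - (if p then c else 0ℤ) ≡ (if not p then c else 0ℤ)
minus-if c true  = +-inverseʳ c
minus-if c false = +-identityʳ c

sumTo-geometric : ∀ n c b →
  sumTo (λ j → monomial 0 c j - monomial (suc n) c j) b ≡ (if b ≤ᵇ n then c else 0ℤ)
sumTo-geometric n c b = begin
  sumTo (λ j → monomial 0 c j - monomial (suc n) c j) b
    ≡⟨ sumTo-minus (monomial 0 c) (monomial (suc n) c) b ⟩
  sumTo (monomial 0 c) b - sumTo (monomial (suc n) c) b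
    ≡⟨ cong₂ _-_ (sumTo-monomial 0 c b) (sumTo-monomial (suc n) c b) ⟩
  c - (if n <ᵇ b then c else 0ℤ)
    ≡⟨ minus-if c (n <ᵇ b) ⟩
  (if not (n <ᵇ b) then c else 0ℤ)
    ≡⟨ cong (if_then c else 0ℤ) (not-<ᵇ n b) ⟩
  (if b ≤ᵇ n then c else 0ℤ) ∎

admissible-∷ʳ : ∀ {d} (k : Vec ℕ (suc d)) b →
  admissible (k ∷ʳ b) ≡ admissible k ∧ (b ≤ᵇ suc (last k))
admissible-∷ʳ (x ∷ [])     b = ∧-identityʳ _
admissible-∷ʳ (x ∷ y ∷ ys) b =
  trans (cong ((y ≤ᵇ suc x) ∧_) (admissible-∷ʳ (y ∷ ys) b)) (sym (∧-assoc (y ≤ᵇ suc x) _ _))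

A-∷ʳ : ∀ d (k : Vec ℕ (suc d)) b →
  A (suc (suc d)) (k ∷ʳ b) ≡ (if b ≤ᵇ suc (last k) then A (suc d) k else 0ℤ)
A-∷ʳ d k b = trans (cong (if_then 1ℤ else 0ℤ) (trans (admissible-∷ʳ k b) (∧-comm (admissible k) _)))
                   (if-∧ (b ≤ᵇ suc (last k)))

divOneMinusLast-∷ʳ : ∀ {d} (g : FPS (suc d)) v b →
  divOneMinusLast g (v ∷ʳ b) ≡ sumTo (λ j → g (v ∷ʳ j)) b
divOneMinusLast-∷ʳ g v b rewrite init-∷ʳ b v | last-∷ʳ b v = refl

embed-∷ʳ : ∀ {d} (f : FPS d) v j → embed f (v ∷ʳ j) ≡ monomial 0 (f v) j
embed-∷ʳ f v zero    rewrite init-∷ʳ 0 v | last-∷ʳ 0 v = refl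
embed-∷ʳ f v (suc j) rewrite last-∷ʳ (suc j) v = refl

substProdLast-∷ʳ : ∀ {e} (C : FPS (suc e)) v j → substProdLast C (v ∷ʳ j) ≡ monomial (last v) (C v) j
substProdLast-∷ʳ C v j rewrite init-∷ʳ j v | last-∷ʳ j v = refl

-- Stated for x² only: mulLastPow recurses through a local function that cannot be named
-- outside Defs, so there is no induction on the exponent.
mulLastPow-2-monomial : ∀ {d} {f : FPS (suc d)} {v a c} →
  (∀ i → f (v ∷ʳ i) ≡ monomial a c i) → ∀ j → mulLastPow 2 f (v ∷ʳ j) ≡ monomial (suc (suc a)) c j
mulLastPow-2-monomial {v = v} f≡ zero          rewrite last-∷ʳ 0 v = refl
mulLastPow-2-monomial {v = v} f≡ (suc zero)    rewrite last-∷ʳ 1 v = refl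
mulLastPow-2-monomial {v = v} f≡ (suc (suc j))
  rewrite last-∷ʳ (suc (suc j)) v | init-∷ʳ (suc (suc j)) v = f≡ j

numerator-∷ʳ : ∀ {e} (C : FPS (suc e)) v j →
  (embed C ⊖ mulLastPow 2 (substProdLast C)) (v ∷ʳ j) ≡
    monomial 0 (C v) j - monomial (suc (suc (last v))) (C v) j
numerator-∷ʳ C v j =
  cong₂ _-_ (embed-∷ʳ C v j) (mulLastPow-2-monomial {f = substProdLast C} {v} (substProdLast-∷ʳ C v) j)

lemma2 : (n : ℕ) →
    A (suc (suc n)) ≋
      divOneMinusLast (embed (A (suc n)) ⊖ mulLastPow 2 (substProdLast (A (suc n))))
lemma2 n k = begin
  A (suc (suc n)) k                            ≡⟨ cong (A (suc (suc n))) k≡init∷ʳlast ⟩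
  A (suc (suc n)) (init k ∷ʳ last k)           ≡⟨ slice (init k) (last k) ⟩
  divOneMinusLast numerator (init k ∷ʳ last k) ≡⟨ cong (divOneMinusLast numerator) k≡init∷ʳlast ⟨
  divOneMinusLast numerator k                  ∎
  where
  numerator : FPS (suc (suc n))
  numerator = embed (A (suc n)) ⊖ mulLastPow 2 (substProdLast (A (suc n)))

  k≡init∷ʳlast : k ≡ init k ∷ʳ last k
  k≡init∷ʳlast = proj₂ (proj₂ (initLast k))

  slice : ∀ v b → A (suc (suc n)) (v ∷ʳ b) ≡ divOneMinusLast numerator (v ∷ʳ b)
  slice v b = begin
    A (suc (suc n)) (v ∷ʳ b)
      ≡⟨ A-∷ʳ n v b ⟩
    (if b ≤ᵇ suc (last v) then A (suc n) v else 0ℤ)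
      ≡⟨ sumTo-geometric (suc (last v)) (A (suc n) v) b ⟨
    sumTo (λ j → monomial 0 (A (suc n) v) j - monomial (suc (suc (last v))) (A (suc n) v) j) b
      ≡⟨ sumTo-cong (numerator-∷ʳ (A (suc n)) v) b ⟨
    sumTo (λ j → numerator (v ∷ʳ j)) b
      ≡⟨ divOneMinusLast-∷ʳ numerator v b ⟨
    divOneMinusLast numerator (v ∷ʳ b) ∎
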